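{- Let $G$ be a graph on vertex set $\{v_1,\dots,v_n\}$ with $r_2(G)=2k$, and let $M \in \mathbb{F}_2^{n\times 2k}$ be the incidence matrix of a minimum $\mathcal{T}$-odd cover of $G$, i.e. a matrix with $M A_k M^\mathsf{T} = A_G$ over $\mathbb{F}_2$. Then a nonempty subset $W \subseteq V(G)$ is an even core of $G$ if and only if the rows of $M$ indexed by the vertices of $W$ sum to the zero vector over $\mathbb{F}_2$.
   Context: Graphs are finite and simple; $A_G$ is the adjacency matrix of $G$ and $r_2(G)$ its rank over $\mathbb{F}_2$. $A_k$ is the direct sum of $k$ copies of $\left( \begin{smallmatrix} 0 & 1 \\ 1 & 0 \end{smallmatrix} \right)$. A $\mathcal{T}$-odd cover of $G$ is a collection of complete tripartite and complete bipartite graphs on subsets of $V(G)$ covering each edge of $G$ an odd number of times and each nonedge an even number of times; minimum $\mathcal{T}$-odd covers (of size $r_2(G)/2$) correspond to $n \times r_2(G)$ matrices $M$ over $\mathbb{F}_2$ with $M A_k M^\mathsf{T}=A_G$, which are called their incidence matrices. An even core of $G$ is a nonempty set $W\subseteq V(G)$ such that every vertex of $G$ has an even number of neighbors in $W$. -}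

module Defs where

open import Data.Nat using (ℕ; zero; suc; _+_; _≡ᵇ_; ⌊_/2⌋)
open import Data.Bool using (Bool; true; false; _xor_; _∧_; not)
open import Data.Fin using (Fin; toℕ)
open import Data.Fin.Subset using (Subset; _∈_; Nonempty)
open import Data.Vec using (lookup)
open import Data.Product using (_×_; Σ; ∃)
open import Relation.Binary.PropositionalEquality using (_≡_; _≢_)
open import Relation.Nullary using (¬_)
open import Function.Definitions using (Injective)

-- The field F₂ is modelled by Bool: addition = xor, multiplication = ∧.

Σ₂ : ∀ {n} → (Fin n → Bool) → Bool
Σ₂ {zero}  f = false
Σ₂ {suc n} f = f Fin.zero xor Σ₂ (λ i → f (Fin.suc i))

Mat : ℕ → ℕ → Set
Mat m n = Fin m → Fin n → Bool

_⊗_ : ∀ {m p n} → Mat m p → Mat p n → Mat m n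
(A ⊗ B) i j = Σ₂ (λ l → A i l ∧ B l j)

transpose : ∀ {m n} → Mat m n → Mat n m
transpose A i j = A j i

record Graph (n : ℕ) : Set where
  field
    adj   : Mat n n
    sym   : ∀ u v → adj u v ≡ adj v u
    irrefl : ∀ v → adj v v ≡ false
open Graph public

-- A_k : direct sum of k copies of [[0,1],[1,0]], indexed by Fin (k + k);
-- block l occupies coordinates 2l and 2l+1.  So entry (i,j) is 1 iff
-- i ≠ j and ⌊i/2⌋ = ⌊j/2⌋.
Aₖ : (k : ℕ) → Mat (k + k) (k + k)
Aₖ k i j = (⌊ toℕ i /2⌋ ≡ᵇ ⌊ toℕ j /2⌋) ∧ not (toℕ i ≡ᵇ toℕ j)

LinearlyIndependent : ∀ {r m} → (Fin r → Fin m → Bool) → Set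
LinearlyIndependent {r} v =
  ∀ (c : Fin r → Bool) → (∀ j → Σ₂ (λ i → c i ∧ v i j) ≡ false) → ∀ i → c i ≡ false

Rank₂ : ∀ {m n} → Mat m n → ℕ → Set
Rank₂ {m} A r =
  (Σ (Fin r → Fin m) λ f → Injective _≡_ _≡_ f × LinearlyIndependent (λ i → A (f i)))
  × (∀ (f : Fin (suc r) → Fin m) → Injective _≡_ _≡_ f → ¬ LinearlyIndependent (λ i → A (f i)))

r₂ : ∀ {n} → Graph n → ℕ → Set
r₂ G r = Rank₂ (adj G) r

IsMinTOddCoverIncidence : ∀ {n} (G : Graph n) (k : ℕ) → Mat n (k + k) → Set
IsMinTOddCoverIncidence G k M = ∀ u v → ((M ⊗ Aₖ k) ⊗ transpose M) u v ≡ adj G u v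

IsEvenCore : ∀ {n} → Graph n → Subset n → Set
IsEvenCore G W = Nonempty W × (∀ v → Σ₂ (λ u → lookup W u ∧ adj G v u) ≡ false)

RowsSumZero : ∀ {n m} → Mat n m → Subset n → Set
RowsSumZero M W = ∀ j → Σ₂ (λ u → lookup W u ∧ M u j) ≡ false

-- Write w for the indicator vector of W. As A_G = M Aₖ Mᵀ is symmetric, W is an
-- even core iff ((wᵀM) Aₖ) Mᵀ = 0, which clearly holds when wᵀM = 0. Conversely,
-- a dependency among rows of M would propagate to the same rows of A_G, so the
-- 2k independent rows of A_G select a square submatrix of M with independent
-- rows. By Gaussian elimination (m + 1 vectors in F₂ᵐ are always dependent) its
-- columns are independent too, which forces (wᵀM) Aₖ = 0; finally Aₖ is the
-- permutation matrix of the involution exchanging 2l and 2l + 1, so wᵀM = 0.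
module Submission where

open import Defs
open import Data.Nat using (ℕ; _+_)
open import Data.Fin.Subset using (Subset; Nonempty)
open import Function.Bundles using (_⇔_; mk⇔)

open import Algebra.Bundles using (CommutativeRing)
open import Data.Bool using (Bool; true; false; _xor_; _∧_; not)
open import Data.Bool.Properties
  using (xor-∧-commutativeRing; xor-comm; xor-same; xor-identityʳ;
         ∧-comm; ∧-assoc; ∧-zeroʳ; ∧-identityʳ; ∧-distribˡ-xor; ¬-not)
  renaming (_≟_ to _≟𝔹_)
open import Data.Empty using (⊥-elim)
open import Data.Fin using (Fin; zero; suc; toℕ; fromℕ<; punchIn; punchOut)
open import Data.Fin.Properties
  using (_≟_; any?; toℕ<n; toℕ-injective; toℕ-fromℕ<; punchInᵢ≢i; punchIn-punchOut)
open import Data.Nat using (zero; suc; _<_; _≡ᵇ_; ⌊_/2⌋; s≤s; z≤n)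
open import Data.Nat.Properties using (+-suc; ≤-pred; n<1+n; m<n⇒m<1+n) renaming (_≟_ to _≟ℕ_)
open import Data.Product using (∃-syntax; _×_; _,_)
open import Data.Vec using (lookup)
open import Data.Vec.Functional using (insertAt; removeAt)
open import Data.Vec.Functional.Properties using (insertAt-lookup; insertAt-punchIn)
open import Function using (_∘_; id; const)
open import Relation.Nullary using (¬_; yes; no)
open import Relation.Nullary.Decidable using (dec-true; dec-false)
open import Relation.Binary.PropositionalEquality as ≡
  using (_≡_; _≢_; _≗_; refl; trans; cong; cong₂; subst; module ≡-Reasoning)

open CommutativeRing xor-∧-commutativeRing using (semiring)
open import Algebra.Properties.Semiring.Sum semiring
  using (sum; sum-cong-≗; sum-replicate-zero; sum-remove; ∑-comm; ∑-distrib-+;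
         *-distribˡ-sum; *-distribʳ-sum)

Σ₂≡sum : ∀ {n} (f : Fin n → Bool) → Σ₂ f ≡ sum f
Σ₂≡sum {zero}  f = refl
Σ₂≡sum {suc n} f = cong (f zero xor_) (Σ₂≡sum (f ∘ suc))

Σ₂-cong : ∀ {n} {f g : Fin n → Bool} → f ≗ g → Σ₂ f ≡ Σ₂ g
Σ₂-cong {f = f} {g} f≗g = trans (Σ₂≡sum f) (trans (sum-cong-≗ f≗g) (≡.sym (Σ₂≡sum g)))

Σ₂-zero : ∀ {n} {f : Fin n → Bool} → f ≗ const false → Σ₂ f ≡ false
Σ₂-zero {n} f≗0 =
  trans (Σ₂-cong {g = const false} f≗0) (trans (Σ₂≡sum {n} (const false)) (sum-replicate-zero n))

Σ₂-comm : ∀ {m n} (f : Fin m → Fin n → Bool) →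
          Σ₂ (λ i → Σ₂ (f i)) ≡ Σ₂ (λ j → Σ₂ (λ i → f i j))
Σ₂-comm f = begin
  Σ₂ (λ i → Σ₂ (f i))            ≡⟨ Σ₂-cong (λ i → Σ₂≡sum (f i)) ⟩
  Σ₂ (λ i → sum (f i))           ≡⟨ Σ₂≡sum (λ i → sum (f i)) ⟩
  sum (λ i → sum (f i))          ≡⟨ ∑-comm f ⟩
  sum (λ j → sum (λ i → f i j))  ≡⟨ Σ₂≡sum (λ j → sum (λ i → f i j)) ⟨
  Σ₂ (λ j → sum (λ i → f i j))   ≡⟨ Σ₂-cong (λ j → Σ₂≡sum (λ i → f i j)) ⟨
  Σ₂ (λ j → Σ₂ (λ i → f i j))    ∎
  where open ≡-Reasoning

Σ₂-distrib-xor : ∀ {n} (f g : Fin n → Bool) → Σ₂ (λ i → f i xor g i) ≡ Σ₂ f xor Σ₂ g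
Σ₂-distrib-xor f g = trans (Σ₂≡sum (λ i → f i xor g i))
  (trans (∑-distrib-+ f g) (≡.sym (cong₂ _xor_ (Σ₂≡sum f) (Σ₂≡sum g))))

∧-distribˡ-Σ₂ : ∀ {n} x (f : Fin n → Bool) → x ∧ Σ₂ f ≡ Σ₂ (λ i → x ∧ f i)
∧-distribˡ-Σ₂ x f = trans (cong (x ∧_) (Σ₂≡sum f))
  (trans (*-distribˡ-sum x f) (≡.sym (Σ₂≡sum (λ i → x ∧ f i))))

∧-distribʳ-Σ₂ : ∀ {n} x (f : Fin n → Bool) → Σ₂ f ∧ x ≡ Σ₂ (λ i → f i ∧ x)
∧-distribʳ-Σ₂ x f = trans (cong (_∧ x) (Σ₂≡sum f))
  (trans (*-distribʳ-sum x f) (≡.sym (Σ₂≡sum (λ i → f i ∧ x))))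

Σ₂-remove : ∀ {n} (p : Fin (suc n)) (f : Fin (suc n) → Bool) → Σ₂ f ≡ f p xor Σ₂ (removeAt f p)
Σ₂-remove p f = trans (Σ₂≡sum f)
  (trans (sum-remove {i = p} f) (cong (f p xor_) (≡.sym (Σ₂≡sum (removeAt f p)))))

Σ₂-select : ∀ {n} (p : Fin n) (f : Fin n → Bool) → (∀ i → i ≢ p → f i ≡ false) → Σ₂ f ≡ f p
Σ₂-select {suc n} p f off-p = begin
  Σ₂ f                          ≡⟨ Σ₂-remove p f ⟩
  f p xor Σ₂ (removeAt f p)     ≡⟨ cong (f p xor_) (Σ₂-zero (λ i → off-p _ (punchInᵢ≢i p i))) ⟩
  f p xor false                 ≡⟨ xor-identityʳ (f p) ⟩
  f p                           ∎
  where open ≡-Reasoning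

infix 7 _·_
infixl 7 _ᵀ⊗_ _⊗ᵥ_

_·_ : ∀ {n} → (Fin n → Bool) → (Fin n → Bool) → Bool
x · y = Σ₂ (λ i → x i ∧ y i)

_ᵀ⊗_ : ∀ {m n} → (Fin m → Bool) → Mat m n → Fin n → Bool
(x ᵀ⊗ A) j = x · (λ i → A i j)

_⊗ᵥ_ : ∀ {m n} → Mat m n → (Fin n → Bool) → Fin m → Bool
(A ⊗ᵥ y) i = A i · y

·-comm : ∀ {n} (x y : Fin n → Bool) → x · y ≡ y · x
·-comm x y = Σ₂-cong (λ i → ∧-comm (x i) (y i))

·-zeroʳ : ∀ {n} (x : Fin n → Bool) {y : Fin n → Bool} → y ≗ const false → x · y ≡ false
·-zeroʳ x y≗0 = Σ₂-zero (λ i → trans (cong (x i ∧_) (y≗0 i)) (∧-zeroʳ (x i)))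

ᵀ⊗-zeroˡ : ∀ {m n} {x : Fin m → Bool} (A : Mat m n) → x ≗ const false → x ᵀ⊗ A ≗ const false
ᵀ⊗-zeroˡ A x≗0 j = Σ₂-zero (λ i → cong (_∧ A i j) (x≗0 i))

ᵀ⊗-congˡ : ∀ {m n} {x y : Fin m → Bool} (A : Mat m n) → x ≗ y → x ᵀ⊗ A ≗ y ᵀ⊗ A
ᵀ⊗-congˡ A x≗y j = Σ₂-cong (λ i → cong (_∧ A i j) (x≗y i))

·-assoc : ∀ {m n} (x : Fin m → Bool) (A : Mat m n) (y : Fin n → Bool) →
          x · (A ⊗ᵥ y) ≡ (x ᵀ⊗ A) · y
·-assoc x A y = begin
  Σ₂ (λ i → x i ∧ Σ₂ (λ j → A i j ∧ y j))
    ≡⟨ Σ₂-cong (λ i → ∧-distribˡ-Σ₂ (x i) (λ j → A i j ∧ y j)) ⟩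
  Σ₂ (λ i → Σ₂ (λ j → x i ∧ (A i j ∧ y j)))
    ≡⟨ Σ₂-comm (λ i j → x i ∧ (A i j ∧ y j)) ⟩
  Σ₂ (λ j → Σ₂ (λ i → x i ∧ (A i j ∧ y j)))
    ≡⟨ Σ₂-cong (λ j → Σ₂-cong (λ i → ∧-assoc (x i) (A i j) (y j))) ⟨
  Σ₂ (λ j → Σ₂ (λ i → (x i ∧ A i j) ∧ y j))
    ≡⟨ Σ₂-cong (λ j → ∧-distribʳ-Σ₂ (y j) (λ i → x i ∧ A i j)) ⟨
  Σ₂ (λ j → (x ᵀ⊗ A) j ∧ y j)
    ∎
  where open ≡-Reasoning

ᵀ⊗-⊗ : ∀ {m p n} (x : Fin m → Bool) (A : Mat m p) (B : Mat p n) → x ᵀ⊗ (A ⊗ B) ≗ (x ᵀ⊗ A) ᵀ⊗ B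
ᵀ⊗-⊗ x A B j = ·-assoc x A (λ l → B l j)

Dependent : ∀ {r m} → (Fin r → Fin m → Bool) → Set
Dependent v = ∃[ c ] (∃[ i ] c i ≡ true) × c ᵀ⊗ v ≗ const false

independent⇒¬dependent : ∀ {r m} {v : Fin r → Fin m → Bool} →
                         LinearlyIndependent v → ¬ Dependent v
independent⇒¬dependent indep (c , (i , cᵢ) , cᵀv≗0) with () ← trans (≡.sym cᵢ) (indep c cᵀv≗0 i)

-- Clear column 0 with the pivot row p, then delete row p and column 0.
eliminate : ∀ {r m} → (Fin (suc r) → Fin (suc m) → Bool) → Fin (suc r) → Fin r → Fin m → Bool
eliminate v p i j = v (punchIn p i) (suc j) xor (v (punchIn p i) zero ∧ v p (suc j))

dependent-pivot : ∀ {r m} (v : Fin (suc r) → Fin (suc m) → Bool) (p : Fin (suc r)) →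
                  v p zero ≡ true → Dependent (eliminate v p) → Dependent v
dependent-pivot v p pivot (c , (i , cᵢ) , cᵀu≗0) =
  d , (punchIn p i , trans (insertAt-punchIn c p t i) cᵢ) , dᵀv≗0
  where
  open ≡-Reasoning
  s = c ᵀ⊗ removeAt v p
  t = s zero
  d = insertAt c p t

  dᵀv : ∀ j → (d ᵀ⊗ v) j ≡ t ∧ v p j xor s j
  dᵀv j = trans (Σ₂-remove p (λ i → d i ∧ v i j)) (cong₂ _xor_
    (cong (_∧ v p j) (insertAt-lookup c p t))
    (Σ₂-cong (λ i → cong (_∧ v (punchIn p i) j) (insertAt-punchIn c p t i))))

  cᵀu : ∀ j → (c ᵀ⊗ eliminate v p) j ≡ s (suc j) xor t ∧ v p (suc j)
  cᵀu j = begin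
    Σ₂ (λ i → c i ∧ (vₚ i (suc j) xor (vₚ i zero ∧ v p (suc j))))
      ≡⟨ Σ₂-cong (λ i → ∧-distribˡ-xor (c i) (vₚ i (suc j)) (vₚ i zero ∧ v p (suc j))) ⟩
    Σ₂ (λ i → (c i ∧ vₚ i (suc j)) xor (c i ∧ (vₚ i zero ∧ v p (suc j))))
      ≡⟨ Σ₂-distrib-xor (λ i → c i ∧ vₚ i (suc j)) (λ i → c i ∧ (vₚ i zero ∧ v p (suc j))) ⟩
    s (suc j) xor Σ₂ (λ i → c i ∧ (vₚ i zero ∧ v p (suc j)))
      ≡⟨ cong (s (suc j) xor_) (Σ₂-cong (λ i → ∧-assoc (c i) (vₚ i zero) (v p (suc j)))) ⟨
    s (suc j) xor Σ₂ (λ i → (c i ∧ vₚ i zero) ∧ v p (suc j))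
      ≡⟨ cong (s (suc j) xor_) (∧-distribʳ-Σ₂ (v p (suc j)) (λ i → c i ∧ vₚ i zero)) ⟨
    s (suc j) xor t ∧ v p (suc j)
      ∎
    where vₚ = removeAt v p

  dᵀv≗0 : d ᵀ⊗ v ≗ const false
  dᵀv≗0 zero = begin
    (d ᵀ⊗ v) zero         ≡⟨ dᵀv zero ⟩
    t ∧ v p zero xor t    ≡⟨ cong (λ b → t ∧ b xor t) pivot ⟩
    t ∧ true xor t        ≡⟨ cong (_xor t) (∧-identityʳ t) ⟩
    t xor t               ≡⟨ xor-same t ⟩
    false                 ∎
  dᵀv≗0 (suc j) = begin
    (d ᵀ⊗ v) (suc j)                 ≡⟨ dᵀv (suc j) ⟩
    t ∧ v p (suc j) xor s (suc j)    ≡⟨ xor-comm (t ∧ v p (suc j)) (s (suc j)) ⟩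
    s (suc j) xor t ∧ v p (suc j)    ≡⟨ cᵀu j ⟨
    (c ᵀ⊗ eliminate v p) j           ≡⟨ cᵀu≗0 j ⟩
    false                            ∎

dependent-zeroColumn : ∀ {r m} (v : Fin r → Fin (suc m) → Bool) → (∀ i → v i zero ≡ false) →
                       Dependent (λ i j → v i (suc j)) → Dependent v
dependent-zeroColumn v zeroColumn (c , nonzero , cᵀv≗0) = c , nonzero , λ where
  zero    → ·-zeroʳ c zeroColumn
  (suc j) → cᵀv≗0 j

dependent : ∀ {r m} → m < r → (v : Fin r → Fin m → Bool) → Dependent v
dependent {suc r} {zero}  _          v = const true , (zero , refl) , λ ()
dependent {suc r} {suc m} (s≤s m<r) v with any? (λ p → v p zero ≟𝔹 true)
... | yes (p , pivot) = dependent-pivot v p pivot (dependent m<r (eliminate v p))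
... | no ¬pivot       = dependent-zeroColumn v (λ i → ¬-not (λ vᵢ → ¬pivot (i , vᵢ)))
                          (dependent (m<n⇒m<1+n m<r) (λ i j → v i (suc j)))

-- If Az = 0 with z p = 1, a dependency c among the columns of A other than p
-- makes cᵀA vanish off p, and (cᵀA)·z = cᵀ(Az) = 0 kills its entry at p too.
independent-transpose : ∀ {m} (A : Mat m m) →
                        LinearlyIndependent A → LinearlyIndependent (transpose A)
independent-transpose {suc m} A indep z zᵀAᵀ≗0 p
  with z p in zₚ | dependent (n<1+n m) (λ i j → A i (punchIn p j))
... | false | _ = refl
... | true  | c , nonzero , cᵀAₚ≗0 =
  ⊥-elim (independent⇒¬dependent {v = A} indep (c , nonzero , cᵀA≗0))
  where
  open ≡-Reasoning
  s = c ᵀ⊗ A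

  s-off-p : ∀ j → j ≢ p → s j ≡ false
  s-off-p j j≢p = subst (λ j → s j ≡ false) (punchIn-punchOut p≢j) (cᵀAₚ≗0 (punchOut p≢j))
    where p≢j = j≢p ∘ ≡.sym

  z∧s-off-p : ∀ j → j ≢ p → z j ∧ s j ≡ false
  z∧s-off-p j j≢p = trans (cong (z j ∧_) (s-off-p j j≢p)) (∧-zeroʳ (z j))

  s-at-p : s p ≡ false
  s-at-p = begin
    s p             ≡⟨ cong (_∧ s p) zₚ ⟨
    z p ∧ s p       ≡⟨ Σ₂-select p (λ j → z j ∧ s j) z∧s-off-p ⟨
    z · s           ≡⟨ ·-comm z s ⟩
    s · z           ≡⟨ ·-assoc c A z ⟨
    c · (A ⊗ᵥ z)    ≡⟨ ·-zeroʳ c (λ i → trans (·-comm (A i) z) (zᵀAᵀ≗0 i)) ⟩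
    false           ∎

  cᵀA≗0 : c ᵀ⊗ A ≗ const false
  cᵀA≗0 j with j ≟ p
  ... | yes refl = s-at-p
  ... | no j≢p   = s-off-p j j≢p

partner : ℕ → ℕ
partner 0             = 1
partner 1             = 0
partner (suc (suc n)) = suc (suc (partner n))

partner-involutive : ∀ n → partner (partner n) ≡ n
partner-involutive 0             = refl
partner-involutive 1             = refl
partner-involutive (suc (suc n)) = cong (λ m → suc (suc m)) (partner-involutive n)

partner-< : ∀ k {n} → n < k + k → partner n < k + k
partner-< (suc k) {0}             _  rewrite +-suc k k = s≤s (s≤s z≤n)
partner-< (suc k) {1}             _  = s≤s z≤n
partner-< (suc k) {suc (suc n)} (s≤s n<) rewrite +-suc k k = s≤s (s≤s (partner-< k (≤-pred n<)))

Aₖ-partner : ∀ k (i j : Fin (k + k)) → Aₖ k i j ≡ (toℕ i ≡ᵇ partner (toℕ j))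
Aₖ-partner k i j = sameBlock (toℕ i) (toℕ j)
  where
  sameBlock : ∀ m n → ((⌊ m /2⌋ ≡ᵇ ⌊ n /2⌋) ∧ not (m ≡ᵇ n)) ≡ (m ≡ᵇ partner n)
  sameBlock 0             0             = refl
  sameBlock 0             1             = refl
  sameBlock 0             (suc (suc n)) = refl
  sameBlock 1             0             = refl
  sameBlock 1             1             = refl
  sameBlock 1             (suc (suc n)) = refl
  sameBlock (suc (suc m)) 0             = refl
  sameBlock (suc (suc m)) 1             = refl
  sameBlock (suc (suc m)) (suc (suc n)) = sameBlock m n

ᵀ⊗-Aₖ : ∀ k (y : Fin (k + k) → Bool) {i j} → toℕ i ≡ partner (toℕ j) → (y ᵀ⊗ Aₖ k) j ≡ y i
ᵀ⊗-Aₖ k y {i} {j} i≡partner-j = begin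
  (y ᵀ⊗ Aₖ k) j
    ≡⟨ Σ₂-cong (λ l → cong (y l ∧_) (Aₖ-partner k l j)) ⟩
  y · (λ l → toℕ l ≡ᵇ partner (toℕ j))
    ≡⟨ Σ₂-cong (λ l → cong (λ n → y l ∧ (toℕ l ≡ᵇ n)) i≡partner-j) ⟨
  y · (λ l → toℕ l ≡ᵇ toℕ i)
    ≡⟨ Σ₂-select i (λ l → y l ∧ (toℕ l ≡ᵇ toℕ i)) off-i ⟩
  y i ∧ (toℕ i ≡ᵇ toℕ i)
    ≡⟨ cong (y i ∧_) (dec-true (toℕ i ≟ℕ toℕ i) refl) ⟩
  y i ∧ true
    ≡⟨ ∧-identityʳ (y i) ⟩
  y i
    ∎
  where
  open ≡-Reasoning
  off-i : ∀ l → l ≢ i → y l ∧ (toℕ l ≡ᵇ toℕ i) ≡ false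
  off-i l l≢i = trans (cong (y l ∧_) (dec-false (toℕ l ≟ℕ toℕ i) (l≢i ∘ toℕ-injective)))
                      (∧-zeroʳ (y l))

Aₖ-independent : ∀ k → LinearlyIndependent (Aₖ k)
Aₖ-independent k y yᵀAₖ≗0 i = trans (≡.sym (ᵀ⊗-Aₖ k y i≡partner-j)) (yᵀAₖ≗0 j)
  where
  j = fromℕ< (partner-< k (toℕ<n i))
  i≡partner-j : toℕ i ≡ partner (toℕ j)
  i≡partner-j = ≡.sym (trans (cong partner (toℕ-fromℕ< _)) (partner-involutive (toℕ i)))

module _ {n} (G : Graph n) (k : ℕ) (M : Mat n (k + k)) (cover : IsMinTOddCoverIncidence G k M) where

  cover-ᵀ⊗ : ∀ {r} (f : Fin r → Fin n) (c : Fin r → Bool) →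
             c ᵀ⊗ (adj G ∘ f) ≗ ((c ᵀ⊗ (M ∘ f)) ᵀ⊗ Aₖ k) ᵀ⊗ transpose M
  cover-ᵀ⊗ f c j = begin
    (c ᵀ⊗ (adj G ∘ f)) j
      ≡⟨ Σ₂-cong (λ i → cong (c i ∧_) (cover (f i) j)) ⟨
    (c ᵀ⊗ (((M ∘ f) ⊗ Aₖ k) ⊗ transpose M)) j
      ≡⟨ ᵀ⊗-⊗ c ((M ∘ f) ⊗ Aₖ k) (transpose M) j ⟩
    ((c ᵀ⊗ ((M ∘ f) ⊗ Aₖ k)) ᵀ⊗ transpose M) j
      ≡⟨ ᵀ⊗-congˡ (transpose M) (ᵀ⊗-⊗ c (M ∘ f) (Aₖ k)) j ⟩
    (((c ᵀ⊗ (M ∘ f)) ᵀ⊗ Aₖ k) ᵀ⊗ transpose M) j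
      ∎
    where open ≡-Reasoning

  cover-independent : ∀ {r} (f : Fin r → Fin n) →
                      LinearlyIndependent (adj G ∘ f) → LinearlyIndependent (M ∘ f)
  cover-independent f indep c cᵀMf≗0 = indep c λ j →
    trans (cover-ᵀ⊗ f c j) (ᵀ⊗-zeroˡ (transpose M) (ᵀ⊗-zeroˡ (Aₖ k) cᵀMf≗0) j)

corollary4 : ∀ {n : ℕ} (G : Graph n) (k : ℕ) → r₂ G (k + k) →
    (M : Mat n (k + k)) → IsMinTOddCoverIncidence G k M →
    (W : Subset n) → Nonempty W → (IsEvenCore G W ⇔ RowsSumZero M W)
corollary4 G k ((f , _ , indep) , _) M cover W nonempty = mk⇔ toRowsSumZero fromRowsSumZero
  where
  w = lookup W

  neighbours : ∀ v → w · adj G v ≡ (((w ᵀ⊗ M) ᵀ⊗ Aₖ k) ᵀ⊗ transpose M) v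
  neighbours v = trans (Σ₂-cong (λ u → cong (w u ∧_) (sym G v u))) (cover-ᵀ⊗ G k M cover id w v)

  toRowsSumZero : IsEvenCore G W → RowsSumZero M W
  toRowsSumZero (_ , even) = Aₖ-independent k (w ᵀ⊗ M)
    (independent-transpose (M ∘ f) (cover-independent G k M cover f indep) _
      (λ i → trans (≡.sym (neighbours (f i))) (even (f i))))

  fromRowsSumZero : RowsSumZero M W → IsEvenCore G W
  fromRowsSumZero wᵀM≗0 =
    nonempty , λ v → trans (neighbours v) (ᵀ⊗-zeroˡ (transpose M) (ᵀ⊗-zeroˡ (Aₖ k) wᵀM≗0) v)
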